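{- If $T\in\mathcal{D}$ and $T\to T'$, then $\mathcal{I}(T)=\mathcal{I}(T')$.
   Context: Terms of $\lambda\Pi/\mathcal{R}$: $t ::= s \mid x \mid f \mid \Pi x{:}t.t \mid t\,t \mid \lambda x{:}t.t$ with $f$ ranging over function symbols; $\mathcal{R}$ is a set of rules $f\,\vec l\to r$; $\to=\to_\beta\cup\to_{\mathcal{R}}$ is assumed locally confluent; $\mathrm{SN}$ is the set of terminating terms and $T{\downarrow}$ the normal form of $T\in\mathrm{SN}$. $\Pi a\in P.Q(a)=\{t\mid\forall a\in P,\ t\,a\in Q(a)\}$. For a partial function $I$ from terms to sets of terms, $D(I)$ is the set of $T\in\mathrm{SN}$ such that whenever $T\to^*\Pi x{:}A.B$, $A\in\mathrm{dom}(I)$ and $B[x\mapsto a]\in\mathrm{dom}(I)$ for all $a\in I(A)$; $F(I)$ has domain $D(I)$, $F(I)(T)=\Pi a\in I(A).I(B[x\mapsto a])$ if $T{\downarrow}=\Pi x{:}A.B$ and $\mathrm{SN}$ otherwise. $\mathcal{I}$ is the least fixpoint of the monotone map $F$ (partial functions ordered by inclusion of graphs) and $\mathcal{D}=D(\mathcal{I})$. -}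

module Defs where

open import Data.Nat using (ℕ; zero; suc)
open import Data.List using (List; foldl)
open import Data.Product using (Σ; Σ-syntax; _×_; ∃)
open import Data.Sum using (_⊎_)
open import Relation.Nullary using (¬_)
open import Relation.Binary.Construct.Closure.ReflexiveTransitive using (Star)
open import Induction.WellFounded using (Acc)

data Sort : Set where
  type kind : Sort

-- Terms of λΠ/R, variables as de Bruijn indices, function symbols named by ℕ.
-- pi A B  is  Πx:A.B  and  lam A t  is  λx:A.t  (x bound as index 0 in B / t).
data Term : Set where
  sort : Sort → Term
  var  : ℕ → Term
  fun  : ℕ → Term
  pi   : Term → Term → Term
  app  : Term → Term → Term
  lam  : Term → Term → Term

liftR : (ℕ → ℕ) → ℕ → ℕ
liftR ρ zero    = zero
liftR ρ (suc n) = suc (ρ n)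

ren : (ℕ → ℕ) → Term → Term
ren ρ (sort s)  = sort s
ren ρ (var n)   = var (ρ n)
ren ρ (fun f)   = fun f
ren ρ (pi A B)  = pi (ren ρ A) (ren (liftR ρ) B)
ren ρ (app t u) = app (ren ρ t) (ren ρ u)
ren ρ (lam A t) = lam (ren ρ A) (ren (liftR ρ) t)

liftS : (ℕ → Term) → ℕ → Term
liftS σ zero    = var zero
liftS σ (suc n) = ren suc (σ n)

sub : (ℕ → Term) → Term → Term
sub σ (sort s)  = sort s
sub σ (var n)   = σ n
sub σ (fun f)   = fun f
sub σ (pi A B)  = pi (sub σ A) (sub (liftS σ) B)
sub σ (app t u) = app (sub σ t) (sub σ u)
sub σ (lam A t) = lam (sub σ A) (sub (liftS σ) t)

single : Term → ℕ → Term
single a zero    = a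
single a (suc n) = var n

_[_] : Term → Term → Term
B [ a ] = sub (single a) B

-- a rewrite rule  f l₁ … lₙ → r  (pattern variables are free variables)
record Rule : Set where
  constructor mkRule
  field
    head : ℕ
    args : List Term
    rhs  : Term

lhs : Rule → Term
lhs r = foldl app (fun (Rule.head r)) (Rule.args r)

module _ (R : Rule → Set) where

  data _⟶_ : Term → Term → Set where
    beta : ∀ A t u → app (lam A t) u ⟶ (t [ u ])
    rule : ∀ r → R r → (σ : ℕ → Term) → sub σ (lhs r) ⟶ sub σ (Rule.rhs r)
    piL  : ∀ {A A'} B → A ⟶ A' → pi A B ⟶ pi A' B
    piR  : ∀ A {B B'} → B ⟶ B' → pi A B ⟶ pi A B'
    appL : ∀ {t t'} u → t ⟶ t' → app t u ⟶ app t' u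
    appR : ∀ t {u u'} → u ⟶ u' → app t u ⟶ app t u'
    lamL : ∀ {A A'} t → A ⟶ A' → lam A t ⟶ lam A' t
    lamR : ∀ A {t t'} → t ⟶ t' → lam A t ⟶ lam A t'

  _⟶*_ : Term → Term → Set
  _⟶*_ = Star _⟶_

  LocallyConfluent : Set
  LocallyConfluent = ∀ {t u v} → t ⟶ u → t ⟶ v → Σ[ w ∈ Term ] (u ⟶* w × v ⟶* w)

  SN : Term → Set
  SN = Acc (λ u t → t ⟶ u)

  Normal : Term → Set
  Normal t = ¬ (Σ[ u ∈ Term ] t ⟶ u)

  NF : Term → Term → Set
  NF T U = T ⟶* U × Normal U

  TSet : Set₁
  TSet = Term → Set

  ΠSet : TSet → (Term → TSet) → TSet
  ΠSet P Q t = ∀ a → P a → Q a (app t a)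

  -- partial functions from terms to sets of terms: domain + values (values
  -- outside the domain are irrelevant)
  record PFun : Set₁ where
    field
      dom : Term → Set
      val : Term → TSet
  open PFun public

  D : PFun → Term → Set
  D I T = SN T × (∀ A B → T ⟶* pi A B →
                   dom I A × (∀ a → val I A a → dom I (B [ a ])))

  F : PFun → PFun
  dom (F I) = D I
  val (F I) T t =
      (Σ[ A ∈ Term ] Σ[ B ∈ Term ]
          (NF T (pi A B) × ΠSet (val I A) (λ a → val I (B [ a ])) t))
    ⊎ ((¬ (Σ[ A ∈ Term ] Σ[ B ∈ Term ] NF T (pi A B))) × SN t)

  -- inclusion of graphs (sets compared extensionally)
  _⊑_ : PFun → PFun → Set
  I ⊑ J = (∀ T → dom I T → dom J T)
        × (∀ T → dom I T → ∀ t → (val I T t → val J T t) × (val J T t → val I T t))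

  _≈_ : PFun → PFun → Set
  I ≈ J = I ⊑ J × J ⊑ I

  IsLeastFixpoint : PFun → Set₁
  IsLeastFixpoint I = (F I ≈ I) × (∀ J → F J ≈ J → I ⊑ J)

{-# OPTIONS --safe #-}
module Submission where

-- Under local confluence a terminating T has at most one normal form, and every
-- reduct T' of T reaches it (Newman). Hence T and T' have the same normal forms,
-- so F I assigns them the same set; as I is a fixpoint of F and both T and T'
-- lie in D(I) = dom (F I), the same holds for I.

open import Defs
open import Data.Product using (_×_; _,_; proj₁; proj₂)
open import Data.Sum using (inj₁; inj₂)
open import Data.Empty using (⊥-elim)
open import Function.Bundles using (_⇔_; mk⇔; Equivalence)
open import Function.Properties.Equivalence using () renaming (trans to ⇔-trans)
open import Function.Construct.Symmetry using (⇔-sym)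
open import Relation.Binary.Construct.Closure.ReflexiveTransitive using (ε; _◅_; _◅◅_)
open import Induction.WellFounded using (acc)

module _ (R : Rule → Set) where

  -- Newman's lemma with a normal target, where plain induction on SN t suffices.
  ⟶*-normal-form : LocallyConfluent R → ∀ {t u v} → SN R t →
    _⟶*_ R t u → _⟶*_ R t v → Normal R v → _⟶*_ R u v
  ⟶*-normal-form lc sn       ε          t⟶*v     v-normal = t⟶*v
  ⟶*-normal-form lc sn       (s ◅ s⟶*u) ε         v-normal = ⊥-elim (v-normal (_ , s))
  ⟶*-normal-form lc (acc rs) (s ◅ s⟶*u) (s' ◅ s'⟶*v) v-normal
    with lc s s'
  ... | _ , s⟶*w , s'⟶*w =
    ⟶*-normal-form lc (rs s) s⟶*u
      (s⟶*w ◅◅ ⟶*-normal-form lc (rs s') s'⟶*w s'⟶*v v-normal) v-normal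

  NF-⟶ : LocallyConfluent R → ∀ {T T'} → SN R T → _⟶_ R T T' →
    ∀ P → NF R T P ⇔ NF R T' P
  NF-⟶ lc sn T⟶T' P =
    mk⇔ (λ (T⟶*P , P-normal) →
           ⟶*-normal-form lc sn (T⟶T' ◅ ε) T⟶*P P-normal , P-normal)
        (λ (T'⟶*P , P-normal) → T⟶T' ◅ T'⟶*P , P-normal)

  D-⟶ : (I : PFun R) → ∀ {T T'} → D R I T → _⟶_ R T T' → D R I T'
  D-⟶ I (acc rs , pi-reducts) T⟶T' =
    rs T⟶T' , λ A B T'⟶*ΠAB → pi-reducts A B (T⟶T' ◅ T'⟶*ΠAB)

  val-F-transport : (I : PFun R) → ∀ {T T'} →
    (∀ P → NF R T P ⇔ NF R T' P) → ∀ t → val (F R I) T t → val (F R I) T' t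
  val-F-transport I same-NF t (inj₁ (A , B , nf , t∈Π)) =
    inj₁ (A , B , Equivalence.to (same-NF _) nf , t∈Π)
  val-F-transport I same-NF t (inj₂ (no-pi-NF , t-sn)) =
    inj₂ ((λ (A , B , nf) → no-pi-NF (A , B , Equivalence.from (same-NF _) nf)) , t-sn)

  val-F-resp-NF : (I : PFun R) → ∀ {T T'} →
    (∀ P → NF R T P ⇔ NF R T' P) → ∀ t → val (F R I) T t ⇔ val (F R I) T' t
  val-F-resp-NF I same-NF t =
    mk⇔ (val-F-transport I same-NF t)
        (val-F-transport I (λ P → ⇔-sym (same-NF P)) t)

  ⊑⇒val⇔ : ∀ {I J} → _⊑_ R I J → ∀ {T} → dom I T → ∀ t → val I T t ⇔ val J T t
  ⊑⇒val⇔ (_ , same-val) T∈I t =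
    mk⇔ (proj₁ (same-val _ T∈I t)) (proj₂ (same-val _ T∈I t))

lemma24 : (R : Rule → Set) → LocallyConfluent R →
    (I : PFun R) → IsLeastFixpoint R I →
    (T T' : Term) → D R I T → _⟶_ R T T' →
    ∀ t → (val I T t → val I T' t) × (val I T' t → val I T t)
lemma24 R lc I ((F⊑I , _) , _) T T' T∈D T⟶T' t =
  Equivalence.to val-T⇔val-T' , Equivalence.from val-T⇔val-T'
  where
    T'∈D : D R I T'
    T'∈D = D-⟶ R I T∈D T⟶T'

    val-T⇔val-T' : val I T t ⇔ val I T' t
    val-T⇔val-T' =
      ⇔-trans (⇔-sym (⊑⇒val⇔ R F⊑I T∈D t))
        (⇔-trans (val-F-resp-NF R I (NF-⟶ R lc (proj₁ T∈D) T⟶T') t)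
                 (⊑⇒val⇔ R F⊑I T'∈D t))
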